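{- Let $M=(V,D)$ be a set system and $u\in V$. If $M$ is strongly divisible by $u$, then for any vertex flip $\rho$, the set system $M\rho$ is strongly divisible by $u$.
   Context: A set system is a pair $M=(V,D)$ with $V$ finite and $D$ a family of subsets of $V$; write $Z\in M$ for $Z\in D$. $\oplus$ is symmetric difference. Pivot: $M*X=(V,\{Z\oplus X:Z\in D\})$ for $X\subseteq V$; loop complementation: $M+w=(V,D\oplus\{Z\cup\{w\}:Z\in D,w\notin Z\})$ for $w\in V$; operations are applied left to right and dual pivot is $M\,\bar{*}\,w=M+w*w+w$. A vertex flip is any element of the group of operations generated by $*w$ and $+w$ for a single $w\in V$ (this group, isomorphic to $S_3$, consists of the identity, $*w$, $+w$, $\bar{*}\,w$, $+w*w$, $*w+w$). $M$ is divisible by $u$ if there are $X_1,X_2\in M$ with $u\in X_1\oplus X_2$. $M$ is strongly divisible by $u$ if it is divisible by $u$ and there is $X\in M$ with $X\oplus\{u\}\notin M$. -}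

module Defs where

open import Data.Nat using (ℕ)
open import Data.Bool using (Bool; true; false; _xor_; _∧_; not; T)
open import Data.Fin using (Fin)
open import Data.Fin.Subset using (Subset; _∈_; _∉_; ⁅_⁆)
open import Data.Vec using (zipWith; _[_]≔_; lookup)
open import Data.Product using (∃; ∃₂; _×_)
open import Relation.Binary.PropositionalEquality using (_≡_)
open import Relation.Nullary using (¬_)

-- Ground set V = Fin n; subsets of V are Subset n (characteristic vectors).
-- A set system M = (V, D) is given by the characteristic function of the
-- family D ⊆ 2^V.
SetSystem : ℕ → Set
SetSystem n = Subset n → Bool

_∈M_ : ∀ {n} → Subset n → SetSystem n → Set
Z ∈M M = T (M Z)

_⊕_ : ∀ {n} → Subset n → Subset n → Subset n
X ⊕ Y = zipWith _xor_ X Y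

pivot : ∀ {n} → SetSystem n → Subset n → SetSystem n
pivot M X Z = M (Z ⊕ X)

-- loop complementation: M + w = (V, D ⊕ {Z ∪ {w} : Z ∈ D, w ∉ Z})
-- Z' lies in the second family iff w ∈ Z' and Z' \ {w} ∈ D.
loopCompl : ∀ {n} → SetSystem n → Fin n → SetSystem n
loopCompl M w Z = M Z xor (lookup Z w ∧ M (Z [ w ]≔ false))

-- The six vertex flips at w (the group generated by *w and +w, ≅ S₃).
data VertexFlip : Set where
  idF      : VertexFlip
  pivF     : VertexFlip
  loopF    : VertexFlip
  dualPivF : VertexFlip
  loopPivF : VertexFlip
  pivLoopF : VertexFlip

applyFlip : ∀ {n} → SetSystem n → VertexFlip → Fin n → SetSystem n
applyFlip M idF      w = M
applyFlip M pivF     w = pivot M ⁅ w ⁆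
applyFlip M loopF    w = loopCompl M w
applyFlip M dualPivF w = loopCompl (pivot (loopCompl M w) ⁅ w ⁆) w
applyFlip M loopPivF w = pivot (loopCompl M w) ⁅ w ⁆
applyFlip M pivLoopF w = loopCompl (pivot M ⁅ w ⁆) w

Divisible : ∀ {n} → SetSystem n → Fin n → Set
Divisible M u = ∃₂ λ X₁ X₂ → X₁ ∈M M × X₂ ∈M M × u ∈ (X₁ ⊕ X₂)

StronglyDivisible : ∀ {n} → SetSystem n → Fin n → Set
StronglyDivisible M u =
  Divisible M u × ∃ λ X → X ∈M M × ¬ ((X ⊕ ⁅ u ⁆) ∈M M)

-- Strong divisibility by u says that M has a member containing u, a member
-- avoiding u, and is not invariant under toggling u (Asymmetric).  A pivot is a
-- translation of 2^V, which preserves all three.  Loop complementation at w maps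
-- the values (a, b) of M on a pair {Z, Z ∪ {w}} with w ∉ Z to (a, a xor b).  For
-- w ≠ u it commutes with toggling u, and every member Z keeps a member Z or Z - w
-- with the same u-coordinate.  For w = u the conditions trade places: a pair
-- {X, X ⊕ {u}} on which M differs yields a member of M + u containing u, and a
-- member of M containing u yields such a pair for M + u.
module Submission where

open import Defs
open import Data.Nat using (ℕ)
open import Data.Bool using (Bool; true; false; _xor_; _∧_; not; T)
open import Data.Bool.Properties
  using (xor-comm; xor-assoc; xor-same; xor-identityʳ; xor-inverseˡ; ¬-not; not-¬; T-≡)
  renaming (_≟_ to _≟ᵇ_)
open import Data.Fin using (Fin; zero; suc; _≟_)
open import Data.Fin.Subset using (Subset; _∈_; ⁅_⁆; ⊥)
open import Data.Fin.Subset.Properties using (x∈⁅x⁆; x≢y⇒x∉⁅y⁆)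
open import Data.Vec using ([]; _∷_; lookup; _[_]≔_)
open import Data.Vec.Properties using (lookup-zipWith; lookup⇒[]=; []=⇒lookup)
open import Data.Vec.Relation.Binary.Pointwise.Inductive
  using (Pointwise-≡⇒≡; zipWith-comm; zipWith-assoc; zipWith-identityʳ)
open import Data.Product using (∃; _×_; _,_; uncurry)
open import Function using (_∘_; id)
open import Function.Bundles using (Equivalence)
open import Relation.Binary.PropositionalEquality
open import Relation.Nullary using (yes; no; contradiction)

private
  variable
    n : ℕ

T⇒≡true : ∀ {b} → T b → b ≡ true
T⇒≡true = Equivalence.to T-≡

≡true⇒T : ∀ {b} → b ≡ true → T b
≡true⇒T = Equivalence.from T-≡

xor-cancelʳ : ∀ a b c → a xor c ≡ b xor c → a ≡ b
xor-cancelʳ true  true  _     _  = refl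
xor-cancelʳ false false _     _  = refl
xor-cancelʳ true  false false ()
xor-cancelʳ true  false true  ()
xor-cancelʳ false true  false ()
xor-cancelʳ false true  true  ()

⊕-comm : (X Y : Subset n) → X ⊕ Y ≡ Y ⊕ X
⊕-comm X Y = Pointwise-≡⇒≡ (zipWith-comm xor-comm X Y)

⊕-assoc : (X Y Z : Subset n) → (X ⊕ Y) ⊕ Z ≡ X ⊕ (Y ⊕ Z)
⊕-assoc X Y Z = Pointwise-≡⇒≡ (zipWith-assoc xor-assoc X Y Z)

⊕-identityʳ : (X : Subset n) → X ⊕ ⊥ ≡ X
⊕-identityʳ X = Pointwise-≡⇒≡ (zipWith-identityʳ xor-identityʳ X)

⊕-cancelʳ : (X Y : Subset n) → (X ⊕ Y) ⊕ Y ≡ X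
⊕-cancelʳ []      []      = refl
⊕-cancelʳ (x ∷ X) (y ∷ Y) = cong₂ _∷_ xor-cancel (⊕-cancelʳ X Y)
  where
  xor-cancel : (x xor y) xor y ≡ x
  xor-cancel = trans (xor-assoc x y y) (trans (cong (x xor_) (xor-same y)) (xor-identityʳ x))

xy⊕z≡xz⊕y : (X Y Z : Subset n) → (X ⊕ Y) ⊕ Z ≡ (X ⊕ Z) ⊕ Y
xy⊕z≡xz⊕y X Y Z = begin
  (X ⊕ Y) ⊕ Z  ≡⟨ ⊕-assoc X Y Z ⟩
  X ⊕ (Y ⊕ Z)  ≡⟨ cong (X ⊕_) (⊕-comm Y Z) ⟩
  X ⊕ (Z ⊕ Y)  ≡⟨ ⊕-assoc X Z Y ⟨
  (X ⊕ Z) ⊕ Y  ∎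
  where open ≡-Reasoning

lookup-⊕ : (X Y : Subset n) (i : Fin n) → lookup (X ⊕ Y) i ≡ lookup X i xor lookup Y i
lookup-⊕ X Y i = lookup-zipWith _xor_ i X Y

lookup-⊕⁅x⁆ : (X : Subset n) (i : Fin n) → lookup (X ⊕ ⁅ i ⁆) i ≡ not (lookup X i)
lookup-⊕⁅x⁆ X i = begin
  lookup (X ⊕ ⁅ i ⁆) i           ≡⟨ lookup-⊕ X ⁅ i ⁆ i ⟩
  lookup X i xor lookup ⁅ i ⁆ i  ≡⟨ cong (lookup X i xor_) ([]=⇒lookup (x∈⁅x⁆ i)) ⟩
  lookup X i xor true            ≡⟨ xor-comm (lookup X i) true ⟩
  not (lookup X i)               ∎
  where open ≡-Reasoning

lookup-⊕⁅y⁆ : (X : Subset n) {i j : Fin n} → i ≢ j → lookup (X ⊕ ⁅ j ⁆) i ≡ lookup X i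
lookup-⊕⁅y⁆ X {i} {j} i≢j = begin
  lookup (X ⊕ ⁅ j ⁆) i           ≡⟨ lookup-⊕ X ⁅ j ⁆ i ⟩
  lookup X i xor lookup ⁅ j ⁆ i  ≡⟨ cong (lookup X i xor_) i∉⁅j⁆ ⟩
  lookup X i xor false           ≡⟨ xor-identityʳ (lookup X i) ⟩
  lookup X i                     ∎
  where
  open ≡-Reasoning
  i∉⁅j⁆ : lookup ⁅ j ⁆ i ≡ false
  i∉⁅j⁆ = ¬-not (x≢y⇒x∉⁅y⁆ i≢j ∘ lookup⇒[]= i ⁅ j ⁆)

[]≔false≡⊕⁅⁆ : (Z : Subset n) (w : Fin n) → lookup Z w ≡ true → Z [ w ]≔ false ≡ Z ⊕ ⁅ w ⁆
[]≔false≡⊕⁅⁆ (true ∷ Z) zero    refl = cong (false ∷_) (sym (⊕-identityʳ Z))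
[]≔false≡⊕⁅⁆ (z ∷ Z)    (suc w) w∈Z  =
  cong₂ _∷_ (sym (xor-identityʳ z)) ([]≔false≡⊕⁅⁆ Z w w∈Z)

module _ (M : SetSystem n) (w : Fin n) {Z : Subset n} where

  loopCompl-∉ : lookup Z w ≡ false → loopCompl M w Z ≡ M Z
  loopCompl-∉ w∉Z = trans (cong (λ b → M Z xor (b ∧ M (Z [ w ]≔ false))) w∉Z) (xor-identityʳ (M Z))

  loopCompl-∈ : lookup Z w ≡ true → loopCompl M w Z ≡ M Z xor M (Z ⊕ ⁅ w ⁆)
  loopCompl-∈ w∈Z = cong₂ (λ b Y → M Z xor (b ∧ M Y)) w∈Z ([]≔false≡⊕⁅⁆ Z w w∈Z)

Asymmetric : SetSystem n → Fin n → Set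
Asymmetric M u = ∃ λ X → M X ≢ M (X ⊕ ⁅ u ⁆)

Contains : SetSystem n → Fin n → Bool → Set
Contains M u b = ∃ λ Z → M Z ≡ true × lookup Z u ≡ b

stronglyDivisible⇒asymmetric : (M : SetSystem n) (u : Fin n) →
  StronglyDivisible M u → Asymmetric M u
stronglyDivisible⇒asymmetric M u (_ , X , X∈M , X⊕u∉M) = X , λ eq → X⊕u∉M (subst T eq X∈M)

divisible∧asymmetric⇒stronglyDivisible : (M : SetSystem n) (u : Fin n) →
  Divisible M u → Asymmetric M u → StronglyDivisible M u
divisible∧asymmetric⇒stronglyDivisible M u div (X , M-X≢M-X⊕u)
  with M X in eX | M (X ⊕ ⁅ u ⁆) in eX⊕u
... | true  | false = div , X , ≡true⇒T eX , subst T eX⊕u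
... | false | true  = div , X ⊕ ⁅ u ⁆ , ≡true⇒T eX⊕u ,
                      λ t → subst T eX (subst (T ∘ M) (⊕-cancelʳ X ⁅ u ⁆) t)
... | true  | true  = contradiction refl M-X≢M-X⊕u
... | false | false = contradiction refl M-X≢M-X⊕u

divisible⇒contains : (M : SetSystem n) (u : Fin n) →
  Divisible M u → Contains M u true × Contains M u false
divisible⇒contains M u (X₁ , X₂ , X₁∈M , X₂∈M , u∈X₁⊕X₂) =
  split (lookup X₁ u) (lookup X₂ u) refl refl
    (trans (sym (lookup-⊕ X₁ X₂ u)) ([]=⇒lookup u∈X₁⊕X₂))
  where
  split : ∀ a b → lookup X₁ u ≡ a → lookup X₂ u ≡ b → a xor b ≡ true →
          Contains M u true × Contains M u false
  split true  false e₁ e₂ _ = (X₁ , T⇒≡true X₁∈M , e₁) , (X₂ , T⇒≡true X₂∈M , e₂)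
  split false true  e₁ e₂ _ = (X₂ , T⇒≡true X₂∈M , e₂) , (X₁ , T⇒≡true X₁∈M , e₁)

contains⇒divisible : (M : SetSystem n) (u : Fin n) →
  Contains M u true → Contains M u false → Divisible M u
contains⇒divisible M u (Z₁ , Z₁∈M , u∈Z₁) (Z₀ , Z₀∈M , u∉Z₀) =
  Z₁ , Z₀ , ≡true⇒T Z₁∈M , ≡true⇒T Z₀∈M ,
  lookup⇒[]= u (Z₁ ⊕ Z₀) (trans (lookup-⊕ Z₁ Z₀ u) (cong₂ _xor_ u∈Z₁ u∉Z₀))

module _ (M : SetSystem n) (X : Subset n) where

  pivot-⊕ : (Z : Subset n) → pivot M X (Z ⊕ X) ≡ M Z
  pivot-⊕ Z = cong M (⊕-cancelʳ Z X)

  pivot-divisible : (u : Fin n) → Divisible M u → Divisible (pivot M X) u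
  pivot-divisible u (X₁ , X₂ , X₁∈M , X₂∈M , u∈X₁⊕X₂) =
    X₁ ⊕ X , X₂ ⊕ X , subst T (sym (pivot-⊕ X₁)) X₁∈M , subst T (sym (pivot-⊕ X₂)) X₂∈M ,
    subst (u ∈_) (sym difference-invariant) u∈X₁⊕X₂
    where
    difference-invariant : (X₁ ⊕ X) ⊕ (X₂ ⊕ X) ≡ X₁ ⊕ X₂
    difference-invariant = begin
      (X₁ ⊕ X) ⊕ (X₂ ⊕ X)  ≡⟨ cong ((X₁ ⊕ X) ⊕_) (⊕-comm X₂ X) ⟩
      (X₁ ⊕ X) ⊕ (X ⊕ X₂)  ≡⟨ ⊕-assoc (X₁ ⊕ X) X X₂ ⟨
      ((X₁ ⊕ X) ⊕ X) ⊕ X₂  ≡⟨ cong (_⊕ X₂) (⊕-cancelʳ X₁ X) ⟩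
      X₁ ⊕ X₂              ∎
      where open ≡-Reasoning

  pivot-asymmetric : (u : Fin n) → Asymmetric M u → Asymmetric (pivot M X) u
  pivot-asymmetric u (Y , M-Y≢M-Y⊕u) = Y ⊕ X , λ eq → M-Y≢M-Y⊕u (begin
    M Y                           ≡⟨ pivot-⊕ Y ⟨
    pivot M X (Y ⊕ X)             ≡⟨ eq ⟩
    pivot M X ((Y ⊕ X) ⊕ ⁅ u ⁆)   ≡⟨ cong (pivot M X) (xy⊕z≡xz⊕y Y X ⁅ u ⁆) ⟩
    pivot M X ((Y ⊕ ⁅ u ⁆) ⊕ X)   ≡⟨ pivot-⊕ (Y ⊕ ⁅ u ⁆) ⟩
    M (Y ⊕ ⁅ u ⁆)                 ∎)
    where open ≡-Reasoning

≢⇒xor≡true : ∀ {a b} → a ≢ b → a xor b ≡ true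
≢⇒xor≡true {b = b} a≢b = trans (cong (_xor b) (¬-not a≢b)) (xor-inverseˡ b)

module _ (M : SetSystem n) (w : Fin n) where

  loopCompl-contains : {u : Fin n} → w ≢ u → ∀ b → Contains M u b → Contains (loopCompl M w) u b
  loopCompl-contains w≢u b (Z , Z∈M , Zᵤ≡b) with lookup Z w in w∈?Z
  ... | false = Z , trans (loopCompl-∉ M w w∈?Z) Z∈M , Zᵤ≡b
  ... | true with M (Z ⊕ ⁅ w ⁆) in eZ⊕w
  ...   | false = Z , trans (loopCompl-∈ M w w∈?Z) (cong₂ _xor_ Z∈M eZ⊕w) , Zᵤ≡b
  ...   | true  = Z ⊕ ⁅ w ⁆ ,
                  trans (loopCompl-∉ M w (trans (lookup-⊕⁅x⁆ Z w) (cong not w∈?Z))) eZ⊕w ,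
                  trans (lookup-⊕⁅y⁆ Z (w≢u ∘ sym)) Zᵤ≡b

  loopCompl-asymmetric-∉ : {u : Fin n} → w ≢ u → {Y : Subset n} → lookup Y w ≡ false →
    M Y ≢ M (Y ⊕ ⁅ u ⁆) → Asymmetric (loopCompl M w) u
  loopCompl-asymmetric-∉ w≢u {Y} w∉Y M-Y≢M-Y⊕u = Y , λ eq → M-Y≢M-Y⊕u (begin
    M Y                        ≡⟨ loopCompl-∉ M w w∉Y ⟨
    loopCompl M w Y            ≡⟨ eq ⟩
    loopCompl M w (Y ⊕ ⁅ _ ⁆)  ≡⟨ loopCompl-∉ M w (trans (lookup-⊕⁅y⁆ Y w≢u) w∉Y) ⟩
    M (Y ⊕ ⁅ _ ⁆)              ∎)
    where open ≡-Reasoning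

  loopCompl-asymmetric : {u : Fin n} → w ≢ u → Asymmetric M u → Asymmetric (loopCompl M w) u
  loopCompl-asymmetric {u} w≢u (X , M-X≢M-X⊕u) with lookup X w in w∈?X
  ... | false = loopCompl-asymmetric-∉ w≢u w∈?X M-X≢M-X⊕u
  ... | true with loopCompl M w X ≟ᵇ loopCompl M w (X ⊕ ⁅ u ⁆)
  ...   | no ne  = X , ne
  -- The pairs of X and of X ⊕ w differ by the same amount in M, so if M + w cannot
  -- tell X from X ⊕ u, then M tells X ⊕ w from X ⊕ w ⊕ u, where M + w agrees with M.
  ...   | yes eq = loopCompl-asymmetric-∉ w≢u (trans (lookup-⊕⁅x⁆ X w) (cong not w∈?X))
                     (λ same → M-X≢M-X⊕u (xor-cancelʳ _ _ _ (begin
    M X xor M (X ⊕ ⁅ w ⁆)                        ≡⟨ loopCompl-∈ M w w∈?X ⟨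
    loopCompl M w X                              ≡⟨ eq ⟩
    loopCompl M w (X ⊕ ⁅ u ⁆)                    ≡⟨ loopCompl-∈ M w (trans (lookup-⊕⁅y⁆ X w≢u) w∈?X) ⟩
    M (X ⊕ ⁅ u ⁆) xor M ((X ⊕ ⁅ u ⁆) ⊕ ⁅ w ⁆)    ≡⟨ cong (λ Y → M (X ⊕ ⁅ u ⁆) xor M Y) (xy⊕z≡xz⊕y X ⁅ u ⁆ ⁅ w ⁆) ⟩
    M (X ⊕ ⁅ u ⁆) xor M ((X ⊕ ⁅ w ⁆) ⊕ ⁅ u ⁆)    ≡⟨ cong (M (X ⊕ ⁅ u ⁆) xor_) same ⟨
    M (X ⊕ ⁅ u ⁆) xor M (X ⊕ ⁅ w ⁆)              ∎)))
    where open ≡-Reasoning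

  loopCompl-contains-∉ : Contains M w false → Contains (loopCompl M w) w false
  loopCompl-contains-∉ (Z , Z∈M , w∉Z) = Z , trans (loopCompl-∉ M w w∉Z) Z∈M , w∉Z

  asymmetric⇒loopCompl-contains : Asymmetric M w → Contains (loopCompl M w) w true
  asymmetric⇒loopCompl-contains (X , M-X≢M-X⊕w) = choose (lookup X w) refl
    where
    member : ∀ Y → lookup Y w ≡ true → M Y ≢ M (Y ⊕ ⁅ w ⁆) → Contains (loopCompl M w) w true
    member Y w∈Y M-Y≢M-Y⊕w = Y , trans (loopCompl-∈ M w w∈Y) (≢⇒xor≡true M-Y≢M-Y⊕w) , w∈Y

    choose : ∀ b → lookup X w ≡ b → Contains (loopCompl M w) w true
    choose true  w∈X = member X w∈X M-X≢M-X⊕w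
    choose false w∉X = member (X ⊕ ⁅ w ⁆) (trans (lookup-⊕⁅x⁆ X w) (cong not w∉X))
      (λ eq → M-X≢M-X⊕w (sym (trans eq (cong M (⊕-cancelʳ X ⁅ w ⁆)))))

  contains⇒loopCompl-asymmetric : Contains M w true → Asymmetric (loopCompl M w) w
  contains⇒loopCompl-asymmetric (Z , Z∈M , w∈Z) = Z , λ eq → not-¬ refl (sym (begin
    not (M (Z ⊕ ⁅ w ⁆))        ≡⟨ cong (_xor M (Z ⊕ ⁅ w ⁆)) Z∈M ⟨
    M Z xor M (Z ⊕ ⁅ w ⁆)      ≡⟨ loopCompl-∈ M w w∈Z ⟨
    loopCompl M w Z            ≡⟨ eq ⟩
    loopCompl M w (Z ⊕ ⁅ w ⁆)  ≡⟨ loopCompl-∉ M w (trans (lookup-⊕⁅x⁆ Z w) (cong not w∈Z)) ⟩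
    M (Z ⊕ ⁅ w ⁆)              ∎))
    where open ≡-Reasoning

  loopCompl-divisible-asymmetric : (u : Fin n) → Divisible M u → Asymmetric M u →
    Divisible (loopCompl M w) u × Asymmetric (loopCompl M w) u
  loopCompl-divisible-asymmetric u div asym with w ≟ u | divisible⇒contains M u div
  ... | yes refl | has-w , lacks-w =
    contains⇒divisible (loopCompl M w) w (asymmetric⇒loopCompl-contains asym) (loopCompl-contains-∉ lacks-w) ,
    contains⇒loopCompl-asymmetric has-w
  ... | no w≢u   | has-u , lacks-u =
    contains⇒divisible (loopCompl M w) u
      (loopCompl-contains w≢u true has-u) (loopCompl-contains w≢u false lacks-u) ,
    loopCompl-asymmetric w≢u asym

pivot-stronglyDivisible : (M : SetSystem n) (X : Subset n) (u : Fin n) →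
  StronglyDivisible M u → StronglyDivisible (pivot M X) u
pivot-stronglyDivisible M X u sd@(div , _) =
  divisible∧asymmetric⇒stronglyDivisible (pivot M X) u (pivot-divisible M X u div)
    (pivot-asymmetric M X u (stronglyDivisible⇒asymmetric M u sd))

loopCompl-stronglyDivisible : (M : SetSystem n) (w u : Fin n) →
  StronglyDivisible M u → StronglyDivisible (loopCompl M w) u
loopCompl-stronglyDivisible M w u sd@(div , _) =
  uncurry (divisible∧asymmetric⇒stronglyDivisible (loopCompl M w) u)
    (loopCompl-divisible-asymmetric M w u div (stronglyDivisible⇒asymmetric M u sd))

lemma13 : ∀ {n} (M : SetSystem n) (u w : Fin n) (ρ : VertexFlip) →
    StronglyDivisible M u → StronglyDivisible (applyFlip M ρ w) u
lemma13 M u w idF      = id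
lemma13 M u w pivF     = pivot-stronglyDivisible M ⁅ w ⁆ u
lemma13 M u w loopF    = loopCompl-stronglyDivisible M w u
lemma13 M u w dualPivF =
  loopCompl-stronglyDivisible (pivot (loopCompl M w) ⁅ w ⁆) w u
  ∘ pivot-stronglyDivisible (loopCompl M w) ⁅ w ⁆ u
  ∘ loopCompl-stronglyDivisible M w u
lemma13 M u w loopPivF =
  pivot-stronglyDivisible (loopCompl M w) ⁅ w ⁆ u ∘ loopCompl-stronglyDivisible M w u
lemma13 M u w pivLoopF =
  loopCompl-stronglyDivisible (pivot M ⁅ w ⁆) w u ∘ pivot-stronglyDivisible M ⁅ w ⁆ u
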